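{- Let $G$ be a $(d,k)$-digraph with repeat permutation $r$, let $\alpha>1$ be an integer, and let $H_\alpha$ be the subdigraph of $G$ induced by the vertices $v$ for which there is an integer $t\geq0$ with $\mathrm{ord}_r(v)\mid 2^t\alpha$. Then $H_\alpha$ is $(r,k)$-closed.
   Context: A $(d,k)$-digraph (almost Moore digraph) is a finite digraph, diregular of degree $d>1$ (every vertex has in- and out-degree $d$), of diameter $k>1$ and order $N=d+d^2+\cdots+d^k$. Every vertex $v$ has a unique vertex $r(v)$ (its repeat) such that there are exactly two walks of length $\leq k$ from $v$ to $r(v)$, at least one of them of length $k$; $r$ is a permutation of $V(G)$ and an automorphism of $G$. $\mathrm{ord}_r(v)$ is the least $t\geq1$ with $r^t(v)=v$. A subdigraph $H$ of $G$ is $(r,k)$-closed if for every two distinct vertices $u,v$ of $H$ every shortest path of length at most $k$ from $u$ to $v$ in $G$ is contained in $H$, and moreover $r(V(H))\subseteq V(H)$. -}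

module Defs where

open import Data.Nat using (ℕ; zero; suc; _+_; _*_; _^_; _≤_; _<_)
open import Data.Nat.Divisibility using (_∣_)
open import Data.Fin using (Fin; zero; suc; inject₁; _≟_)
open import Data.Fin.Properties using ()
open import Data.Vec using (Vec; lookup; head; last)
open import Data.List using (List; map; allFin)
open import Data.Nat.ListAction using (sum)
open import Data.Bool using (Bool; true; false; if_then_else_)
open import Data.Product using (Σ; ∃; _×_; _,_)
open import Relation.Nullary using (¬_; does)
open import Relation.Binary.PropositionalEquality using (_≡_; _≢_)

-- A finite digraph on vertex set Fin n, given by its (Boolean) adjacency
-- relation: there is an arc u → w iff A u w ≡ true.
Adj : ℕ → Set
Adj n = Fin n → Fin n → Bool

∑ : ∀ {n} → (Fin n → ℕ) → ℕ
∑ {n} f = sum (map f (allFin n))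

b2n : Bool → ℕ
b2n true  = 1
b2n false = 0

outdeg : ∀ {n} → Adj n → Fin n → ℕ
outdeg A v = ∑ (λ w → b2n (A v w))

indeg : ∀ {n} → Adj n → Fin n → ℕ
indeg A v = ∑ (λ w → b2n (A w v))

Diregular : ∀ {n} → Adj n → ℕ → Set
Diregular A d = ∀ v → (outdeg A v ≡ d) × (indeg A v ≡ d)

-- A walk of length ℓ, given by its sequence of ℓ+1 vertices.
IsWalk : ∀ {n ℓ} → Adj n → Vec (Fin n) (suc ℓ) → Set
IsWalk {ℓ = ℓ} A xs = ∀ (i : Fin ℓ) → A (lookup xs (inject₁ i)) (lookup xs (suc i)) ≡ true

Reach : ∀ {n} → Adj n → ℕ → Fin n → Fin n → Set
Reach {n} A ℓ u v =
  Σ (Vec (Fin n) (suc ℓ)) λ xs → IsWalk A xs × (head xs ≡ u) × (last xs ≡ v)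

Diameter : ∀ {n} → Adj n → ℕ → Set
Diameter A k =
  (∀ u v → Σ ℕ λ ℓ → (ℓ ≤ k) × Reach A ℓ u v) ×
  (∃ λ u → ∃ λ v → ∀ ℓ → ℓ < k → ¬ Reach A ℓ u v)

mooreSum : ℕ → ℕ → ℕ
mooreSum d zero    = 0
mooreSum d (suc k) = mooreSum d k + d ^ suc k

IsDKDigraph : ∀ {n} → Adj n → ℕ → ℕ → Set
IsDKDigraph {n} A d k =
  (2 ≤ d) × (2 ≤ k) × Diregular A d × Diameter A k × (n ≡ mooreSum d k)

numWalks : ∀ {n} → Adj n → ℕ → Fin n → Fin n → ℕ
numWalks A zero    u v = if does (u ≟ v) then 1 else 0
numWalks A (suc ℓ) u v = ∑ (λ w → if A u w then numWalks A ℓ w v else 0)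

numWalksUpTo : ∀ {n} → Adj n → ℕ → Fin n → Fin n → ℕ
numWalksUpTo A zero    u v = numWalks A zero u v
numWalksUpTo A (suc k) u v = numWalksUpTo A k u v + numWalks A (suc k) u v

RepeatOf : ∀ {n} → Adj n → ℕ → Fin n → Fin n → Set
RepeatOf A k v w = (numWalksUpTo A k v w ≡ 2) × (1 ≤ numWalks A k v w)

IsRepeat : ∀ {n} → Adj n → ℕ → (Fin n → Fin n) → Set
IsRepeat A k r = ∀ v → RepeatOf A k v (r v) × (∀ w → RepeatOf A k v w → w ≡ r v)

iter : ∀ {a} {X : Set a} → (X → X) → ℕ → X → X
iter f zero    x = x
iter f (suc t) x = f (iter f t x)

IsOrd : ∀ {n} → (Fin n → Fin n) → Fin n → ℕ → Set
IsOrd r v m = (1 ≤ m) × (iter r m v ≡ v) × (∀ t → 1 ≤ t → t < m → iter r t v ≢ v)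

InH : ∀ {n} → (Fin n → Fin n) → ℕ → Fin n → Set
InH r α v = Σ ℕ λ m → IsOrd r v m × Σ ℕ λ t → m ∣ 2 ^ t * α

-- the subdigraph of G induced by vertex set S is (r,k)-closed
-- (being induced, a path lies in it iff all its vertices lie in S)
RKClosed : ∀ {n} → Adj n → ℕ → (Fin n → Fin n) → (Fin n → Set) → Set
RKClosed {n} A k r S =
  (∀ u v → u ≢ v → S u → S v →
     ∀ ℓ → ℓ ≤ k → (xs : Vec (Fin n) (suc ℓ)) → IsWalk A xs →
     head xs ≡ u → last xs ≡ v →
     (∀ m → m < ℓ → ¬ Reach A m u v) →
     ∀ i → S (lookup xs i)) ×
  (∀ v → S v → S (r v))

{-# OPTIONS --safe #-}
-- Counting walks, I + A + ⋯ + Aᵏ = J + R, where A is the adjacency matrix, J the all-ones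
-- matrix and R u v = 1 iff v = r u; the column sums of R then make r injective.  Since A
-- commutes with I + A + ⋯ + Aᵏ and, by diregularity, AJ = dJ = JA, it commutes with R, so r is
-- an automorphism.  If r^M fixes u and v, then r^M permutes the at most two walks of a given
-- length ≤ k from u to v, so r^(2M) fixes every vertex on them.  With M = 2ᵗα a common period
-- of u and v, every such vertex has order dividing 2ᵗ⁺¹α.
module Submission where

open import Defs
open import Data.Nat using (ℕ; zero; suc; _+_; _*_; _^_; _∸_; _≤_; _<_; _⊔_; z≤n; s≤s)
open import Data.Fin using (Fin; zero; suc; _≟_; toℕ; inject₁)
open import Data.Fin.Properties using (pigeonhole; toℕ≤pred[n])
open import Data.Vec using (Vec; []; _∷_; head; last; lookup) renaming (map to Vmap)
open import Data.Vec.Properties using (lookup-map; ∷-injectiveˡ; ∷-injectiveʳ) renaming (map-id to Vmap-id; map-∘ to Vmap-∘)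
open import Data.List using (List; []; _∷_; [_]; map; concat; concatMap; length; allFin)
open import Data.List.Properties using (length-++; length-map; map-cong; map-∘; map-tabulate)
import Data.Nat.ListAction as List
open import Data.List.Membership.Propositional using (_∈_)
open import Data.List.Membership.Propositional.Properties using (∈-concat⁺′; ∈-map⁺; ∈-allFin; ∈-length)
open import Data.List.Relation.Unary.Any using (here; index)
open import Data.List.Relation.Unary.Any.Properties using (lookup-index)
open import Data.Bool using (true; false; if_then_else_)
open import Data.Product using (Σ; ∃; _×_; _,_; proj₁; proj₂)
open import Data.Sum using (inj₁; inj₂)
open import Function using (_∘_; Injective)
open import Relation.Nullary using (¬_; does; yes; no; contradiction)
open import Relation.Nullary.Decidable using (_×-dec_)
open import Relation.Unary using (Decidable)
open import Relation.Binary.PropositionalEquality using (_≡_; refl; sym; trans; cong; cong₂; subst; subst₂; module ≡-Reasoning)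
open import Data.Nat.Properties hiding (_≟_)
open import Data.Nat.Divisibility using (_∣_; divides; ∣-refl; 1∣_; *-monoʳ-∣; *-monoˡ-∣; m%n≡0⇒n∣m)
open import Data.Nat.DivMod using (_%_; _/_; m≡m%n+[m/n]*n; m%n<n)
open import Data.Nat.Induction using (<-rec)
open import Algebra.Properties.Semiring.Sum +-*-semiring
  using (sum; sum-cong-≗; sum-replicate-zero; ∑-distrib-+; ∑-comm; *-distribˡ-sum; *-distribʳ-sum)

private
  variable
    X Y : Set
    n m ℓ : ℕ

-- Iterates and periods

module _ (f : X → X) where

  iter-+ : ∀ a b x → iter f (a + b) x ≡ iter f a (iter f b x)
  iter-+ zero    b x = refl
  iter-+ (suc a) b x = cong f (iter-+ a b x)

  iter-* : ∀ c m x → iter (iter f m) c x ≡ iter f (c * m) x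
  iter-* zero    m x = refl
  iter-* (suc c) m x = trans (cong (iter f m) (iter-* c m x)) (sym (iter-+ m (c * m) x))

  iter-comm : ∀ m x → iter f m (f x) ≡ f (iter f m x)
  iter-comm zero    x = refl
  iter-comm (suc m) x = cong f (iter-comm m x)

  iter-periodic : ∀ {m P x} → iter f m x ≡ x → m ∣ P → iter f P x ≡ x
  iter-periodic {m} {x = x} fix (divides q refl) = trans (sym (iter-* q m x)) (go q)
    where
    go : ∀ q → iter (iter f m) q x ≡ x
    go zero    = refl
    go (suc q) = trans (cong (iter f m) (go q)) fix

  iter-injective : Injective _≡_ _≡_ f → ∀ m → Injective _≡_ _≡_ (iter f m)
  iter-injective f-inj zero    eq = eq
  iter-injective f-inj (suc m) eq = iter-injective f-inj m (f-inj eq)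

  iter-preserves : ∀ {P : X → Set} → (∀ {x} → P x → P (f x)) → ∀ m {x} → P x → P (iter f m x)
  iter-preserves f-pres zero    p = p
  iter-preserves {P} f-pres (suc m) p = f-pres (iter-preserves {P} f-pres m p)

  iter-homomorphic : ∀ {R : X → X → Set} → (∀ {x y} → R x y → R (f x) (f y)) →
                     ∀ m {x y} → R x y → R (iter f m x) (iter f m y)
  iter-homomorphic f-hom zero    xRy = xRy
  iter-homomorphic {R} f-hom (suc m) xRy = f-hom (iter-homomorphic {R} f-hom m xRy)

orbit-returns : ∀ {g : X → X} {x} → Injective _≡_ _≡_ g → (L : List X) → (∀ t → iter g t x ∈ L) →
                ∃ λ c → 1 ≤ c × c ≤ length L × iter g c x ≡ x
orbit-returns {g = g} {x} g-inj L orbit⊆L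
  with pigeonhole (n<1+n (length L)) (λ i → index (orbit⊆L (toℕ i)))
... | i , j , i<j , same-index = c , m<n⇒0<n∸m i<j , c≤length , returns
  where
  c = toℕ j ∸ toℕ i
  c≤length : c ≤ length L
  c≤length = ≤-trans (m∸n≤m (toℕ j) (toℕ i)) (toℕ≤pred[n] j)
  gⁱx≡gʲx : iter g (toℕ i) x ≡ iter g (toℕ j) x
  gⁱx≡gʲx = trans (lookup-index (orbit⊆L (toℕ i)))
              (trans (cong (Data.List.lookup L) same-index) (sym (lookup-index (orbit⊆L (toℕ j)))))
  returns : iter g c x ≡ x
  returns = sym (iter-injective g g-inj (toℕ i) (begin
    iter g (toℕ i) x                   ≡⟨ gⁱx≡gʲx ⟩
    iter g (toℕ j) x                   ≡⟨ cong (λ t → iter g t x) (sym (m+[n∸m]≡n (<⇒≤ i<j))) ⟩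
    iter g (toℕ i + c) x               ≡⟨ iter-+ g (toℕ i) c x ⟩
    iter g (toℕ i) (iter g c x)        ∎))
    where open ≡-Reasoning

least-witness : ∀ {P : ℕ → Set} → Decidable P → ∀ {n} → P n → ∃ λ m → P m × (∀ {t} → t < m → ¬ P t)
least-witness {P} P? {n} = <-rec (λ n → P n → Least) step n
  where
  Least : Set
  Least = ∃ λ m → P m × (∀ {t} → t < m → ¬ P t)
  step : ∀ n → (∀ {t} → t < n → P t → Least) → P n → Least
  step n rec Pn with anyUpTo? P? n
  ... | yes (t , t<n , Pt) = rec t<n Pt
  ... | no none            = n , Pn , λ t<n Pt → none (_ , t<n , Pt)

module _ (r : Fin n → Fin n) {x : Fin n} where

  IsOrd-exists : ∀ {P} → 1 ≤ P → iter r P x ≡ x → ∃ (IsOrd r x)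
  IsOrd-exists 1≤P fix with least-witness (λ t → (1 ≤? t) ×-dec (iter r t x ≟ x)) (1≤P , fix)
  ... | m , (1≤m , fixₘ) , minimal = m , 1≤m , fixₘ , λ t 1≤t t<m fixₜ → minimal t<m (1≤t , fixₜ)

  IsOrd⇒smaller-period≡0 : ∀ {m t} → IsOrd r x m → t < m → iter r t x ≡ x → t ≡ 0
  IsOrd⇒smaller-period≡0 {t = zero}  _                 _   _    = refl
  IsOrd⇒smaller-period≡0 {t = suc t} (_ , _ , minimal) t<m fixₜ = contradiction fixₜ (minimal (suc t) (s≤s z≤n) t<m)

  IsOrd⇒∣period : ∀ {m P} → IsOrd r x m → iter r P x ≡ x → m ∣ P
  IsOrd⇒∣period {m@(suc _)} {P} ord@(_ , fixₘ , _) fixₚ =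
    m%n≡0⇒n∣m P m (IsOrd⇒smaller-period≡0 ord (m%n<n P m) remainder-period)
    where
    open ≡-Reasoning
    remainder-period : iter r (P % m) x ≡ x
    remainder-period = begin
      iter r (P % m) x                        ≡⟨ cong (iter r (P % m)) (iter-periodic r fixₘ (divides (P / m) refl)) ⟨
      iter r (P % m) (iter r (P / m * m) x)   ≡⟨ iter-+ r (P % m) (P / m * m) x ⟨
      iter r (P % m + P / m * m) x            ≡⟨ cong (λ t → iter r t x) (m≡m%n+[m/n]*n P m) ⟨
      iter r P x                              ≡⟨ fixₚ ⟩
      x                                       ∎

^-monoʳ-∣ : ∀ k {s t} → s ≤ t → k ^ s ∣ k ^ t
^-monoʳ-∣ k {t = t} z≤n = 1∣ (k ^ t)
^-monoʳ-∣ k (s≤s s≤t)   = *-monoʳ-∣ k (^-monoʳ-∣ k s≤t)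

module _ {r : Fin n → Fin n} {α : ℕ} where

  InH⇒fixed : ∀ {x} → InH r α x → ∃ λ t → iter r (2 ^ t * α) x ≡ x
  InH⇒fixed (m , (_ , fixₘ , _) , t , m∣2ᵗα) = t , iter-periodic r fixₘ m∣2ᵗα

  fixed⇒InH : ∀ {x} t → 1 ≤ α → iter r (2 ^ t * α) x ≡ x → InH r α x
  fixed⇒InH t 1≤α fix with IsOrd-exists r (*-mono-≤ (m^n>0 2 t) 1≤α) fix
  ... | m , ord = m , ord , t , IsOrd⇒∣period r ord fix

  fixed-mono : ∀ {x s t} → s ≤ t → iter r (2 ^ s * α) x ≡ x → iter r (2 ^ t * α) x ≡ x
  fixed-mono s≤t fix = iter-periodic r fix (*-monoˡ-∣ α (^-monoʳ-∣ 2 s≤t))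

  InH-closed-under-r : ∀ {x} → 1 ≤ α → InH r α x → InH r α (r x)
  InH-closed-under-r 1≤α x∈H with InH⇒fixed x∈H
  ... | t , fix = fixed⇒InH t 1≤α (trans (iter-comm r (2 ^ t * α) _) (cong r fix))

-- Finite sums and matrices

∑≡sum : (f : Fin n → ℕ) → ∑ f ≡ sum f
∑≡sum f = trans (cong List.sum (map-tabulate (λ i → i) f)) (sum-tabulate f)
  where
  sum-tabulate : ∀ {n} (f : Fin n → ℕ) → List.sum (Data.List.tabulate f) ≡ sum f
  sum-tabulate {zero}  f = refl
  sum-tabulate {suc n} f = cong (f zero +_) (sum-tabulate (f ∘ suc))

sum-ones : sum {n} (λ _ → 1) ≡ n
sum-ones {zero}  = refl
sum-ones {suc n} = cong suc (sum-ones {n})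

sum-mono-≤ : {f g : Fin n → ℕ} → (∀ i → f i ≤ g i) → sum f ≤ sum g
sum-mono-≤ {zero}  f≤g = z≤n
sum-mono-≤ {suc n} f≤g = +-mono-≤ (f≤g zero) (sum-mono-≤ (f≤g ∘ suc))

+-mono-≤-rigid : ∀ {a b c d} → a ≤ c → b ≤ d → c + d ≤ a + b → a ≡ c × b ≡ d
+-mono-≤-rigid {a} {b} {c} {d} a≤c b≤d c+d≤a+b =
    ≤-antisym a≤c (+-cancelʳ-≤ d c a (≤-trans c+d≤a+b (+-monoʳ-≤ a b≤d)))
  , ≤-antisym b≤d (+-cancelˡ-≤ c d b (≤-trans c+d≤a+b (+-monoˡ-≤ b a≤c)))

sum-mono-≤-rigid : {f g : Fin n → ℕ} → (∀ i → f i ≤ g i) → sum g ≤ sum f → ∀ i → f i ≡ g i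
sum-mono-≤-rigid {suc n} f≤g Σg≤Σf i with +-mono-≤-rigid (f≤g zero) (sum-mono-≤ (f≤g ∘ suc)) Σg≤Σf
sum-mono-≤-rigid f≤g Σg≤Σf zero    | f₀≡g₀ , _     = f₀≡g₀
sum-mono-≤-rigid f≤g Σg≤Σf (suc i) | _     , Σf≡Σg = sum-mono-≤-rigid (f≤g ∘ suc) (≤-reflexive (sym Σf≡Σg)) i

Matrix : ℕ → Set
Matrix n = Fin n → Fin n → ℕ

infixl 7 _·_
infixl 6 _⊕_
infix  4 _≋_

_·_ : Matrix n → Matrix n → Matrix n
(M · N) u v = sum λ w → M u w * N w v

_⊕_ : Matrix n → Matrix n → Matrix n
(M ⊕ N) u v = M u v + N u v

_≋_ : Matrix n → Matrix n → Set
M ≋ N = ∀ u v → M u v ≡ N u v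

I : Matrix n
I u v = if does (u ≟ v) then 1 else 0

J : Matrix n
J _ _ = 1

I-diag : (u : Fin n) → I u u ≡ 1
I-diag u with u ≟ u
... | yes _   = refl
... | no u≢u = contradiction refl u≢u

I≡1⇒≡ : {u v : Fin n} → I u v ≡ 1 → u ≡ v
I≡1⇒≡ {u = u} {v} I≡1 with u ≟ v
... | yes u≡v = u≡v

I≤1 : (u v : Fin n) → I u v ≤ 1
I≤1 u v with u ≟ v
... | yes _ = ≤-refl
... | no  _ = z≤n

I-sym : (u v : Fin n) → I u v ≡ I v u
I-sym zero    zero    = refl
I-sym zero    (suc v) = refl
I-sym (suc u) zero    = refl
I-sym (suc u) (suc v) = I-sym u v

I-injective : {f : Fin m → Fin n} → Injective _≡_ _≡_ f → ∀ x y → I (f x) (f y) ≡ I x y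
I-injective {f = f} f-inj x y with f x ≟ f y | x ≟ y
... | yes _     | yes _   = refl
... | no  _     | no  _   = refl
... | yes fx≡fy | no x≢y  = contradiction (f-inj fx≡fy) x≢y
... | no fx≢fy  | yes x≡y = contradiction (cong f x≡y) fx≢fy

I-select : (u : Fin n) (f : Fin n → ℕ) → sum (λ w → I u w * f w) ≡ f u
I-select {suc n} zero    f = trans (cong₂ _+_ (+-identityʳ (f zero)) (sum-replicate-zero n)) (+-identityʳ (f zero))
I-select         (suc u) f = I-select u (f ∘ suc)

I-identityˡ : (M : Matrix n) → I · M ≋ M
I-identityˡ M u v = I-select u (λ w → M w v)

I-identityʳ : (M : Matrix n) → M · I ≋ M
I-identityʳ M u v = trans (sum-cong-≗ λ w → trans (*-comm (M u w) _) (cong (_* M u w) (I-sym w v))) (I-select v (M u))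

·-J : (M : Matrix n) → ∀ u v → (M · J) u v ≡ sum (M u)
·-J M u v = sum-cong-≗ λ w → *-identityʳ (M u w)

J-· : (M : Matrix n) → ∀ u v → (J · M) u v ≡ sum (λ w → M w v)
J-· M u v = sum-cong-≗ λ w → *-identityˡ (M w v)

·-assoc : (M N P : Matrix n) → (M · N) · P ≋ M · (N · P)
·-assoc M N P u v = begin
  sum (λ x → sum (λ w → M u w * N w x) * P x v)     ≡⟨ sum-cong-≗ (λ x → *-distribʳ-sum (P x v) λ w → M u w * N w x) ⟩
  sum (λ x → sum (λ w → M u w * N w x * P x v))     ≡⟨ ∑-comm (λ x w → M u w * N w x * P x v) ⟩
  sum (λ w → sum (λ x → M u w * N w x * P x v))     ≡⟨ sum-cong-≗ (λ w → sum-cong-≗ λ x → *-assoc (M u w) (N w x) (P x v)) ⟩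
  sum (λ w → sum (λ x → M u w * (N w x * P x v)))   ≡⟨ sum-cong-≗ (λ w → *-distribˡ-sum (M u w) λ x → N w x * P x v) ⟨
  sum (λ w → M u w * sum (λ x → N w x * P x v))     ∎
  where open ≡-Reasoning

·-congˡ : {M M′ : Matrix n} (N : Matrix n) → M ≋ M′ → M · N ≋ M′ · N
·-congˡ N M≋M′ u v = sum-cong-≗ λ w → cong (_* N w v) (M≋M′ u w)

·-congʳ : (M : Matrix n) {N N′ : Matrix n} → N ≋ N′ → M · N ≋ M · N′
·-congʳ M N≋N′ u v = sum-cong-≗ λ w → cong (M u w *_) (N≋N′ w v)

·-distribˡ-⊕ : (M N P : Matrix n) → M · (N ⊕ P) ≋ M · N ⊕ M · P
·-distribˡ-⊕ M N P u v =
  trans (sum-cong-≗ λ w → *-distribˡ-+ (M u w) (N w v) (P w v)) (∑-distrib-+ (λ w → M u w * N w v) _)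

·-distribʳ-⊕ : (M N P : Matrix n) → (M ⊕ N) · P ≋ M · P ⊕ N · P
·-distribʳ-⊕ M N P u v =
  trans (sum-cong-≗ λ w → *-distribʳ-+ (P w v) (M u w) (N u w)) (∑-distrib-+ (λ w → M u w * P w v) _)

RowSums : Matrix n → ℕ → Set
RowSums M c = ∀ u → sum (M u) ≡ c

ColSums : Matrix n → ℕ → Set
ColSums M c = ∀ v → sum (λ u → M u v) ≡ c

RowSums-cong : {M N : Matrix n} {c : ℕ} → M ≋ N → RowSums M c → RowSums N c
RowSums-cong M≋N ΣM u = trans (sum-cong-≗ (λ v → sym (M≋N u v))) (ΣM u)

ColSums-cong : {M N : Matrix n} {c : ℕ} → M ≋ N → ColSums M c → ColSums N c
ColSums-cong M≋N ΣM v = trans (sum-cong-≗ (λ u → sym (M≋N u v))) (ΣM v)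

RowSums-⊕ : {M N : Matrix n} {a b : ℕ} → RowSums M a → RowSums N b → RowSums (M ⊕ N) (a + b)
RowSums-⊕ {M = M} {N} ΣM ΣN u = trans (∑-distrib-+ (M u) (N u)) (cong₂ _+_ (ΣM u) (ΣN u))

ColSums-⊕ : {M N : Matrix n} {a b : ℕ} → ColSums M a → ColSums N b → ColSums (M ⊕ N) (a + b)
ColSums-⊕ {M = M} {N} ΣM ΣN v = trans (∑-distrib-+ (λ u → M u v) (λ u → N u v)) (cong₂ _+_ (ΣM v) (ΣN v))

RowSums-· : {M N : Matrix n} {a b : ℕ} → RowSums M a → RowSums N b → RowSums (M · N) (a * b)
RowSums-· {M = M} {N} {a} {b} ΣM ΣN u = begin
  sum (λ v → sum (λ w → M u w * N w v))   ≡⟨ ∑-comm (λ v w → M u w * N w v) ⟩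
  sum (λ w → sum (λ v → M u w * N w v))   ≡⟨ sum-cong-≗ (λ w → *-distribˡ-sum (M u w) (N w)) ⟨
  sum (λ w → M u w * sum (N w))           ≡⟨ sum-cong-≗ (λ w → cong (M u w *_) (ΣN w)) ⟩
  sum (λ w → M u w * b)                   ≡⟨ *-distribʳ-sum b (M u) ⟨
  sum (M u) * b                           ≡⟨ cong (_* b) (ΣM u) ⟩
  a * b                                   ∎
  where open ≡-Reasoning

ColSums-· : {M N : Matrix n} {a b : ℕ} → ColSums M a → ColSums N b → ColSums (M · N) (a * b)
ColSums-· {M = M} {N} {a} {b} ΣM ΣN v = begin
  sum (λ u → sum (λ w → M u w * N w v))   ≡⟨ ∑-comm (λ u w → M u w * N w v) ⟩
  sum (λ w → sum (λ u → M u w * N w v))   ≡⟨ sum-cong-≗ (λ w → *-distribʳ-sum (N w v) (λ u → M u w)) ⟨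
  sum (λ w → sum (λ u → M u w) * N w v)   ≡⟨ sum-cong-≗ (λ w → cong (_* N w v) (ΣM w)) ⟩
  sum (λ w → a * N w v)                   ≡⟨ *-distribˡ-sum a (λ w → N w v) ⟨
  a * sum (λ w → N w v)                   ≡⟨ cong (a *_) (ΣN v) ⟩
  a * b                                   ∎
  where open ≡-Reasoning

RowSums-I : RowSums (I {n}) 1
RowSums-I u = trans (sym (·-J I u u)) (I-identityˡ J u u)

ColSums-I : ColSums (I {n}) 1
ColSums-I v = trans (sym (J-· I v v)) (I-identityʳ J v v)

-- Walks

Vmap-injective : ∀ {f : X → Y} → Injective _≡_ _≡_ f → Injective _≡_ _≡_ (Vmap {n = n} f)
Vmap-injective f-inj {[]}     {[]}     _  = refl
Vmap-injective f-inj {x ∷ xs} {y ∷ ys} eq =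
  cong₂ _∷_ (f-inj (∷-injectiveˡ eq)) (Vmap-injective f-inj (∷-injectiveʳ eq))

iter-Vmap : ∀ (f : X → X) c (xs : Vec X n) → iter (Vmap f) c xs ≡ Vmap (iter f c) xs
iter-Vmap f zero    xs = sym (Vmap-id xs)
iter-Vmap f (suc c) xs = trans (cong (Vmap f) (iter-Vmap f c xs)) (sym (Vmap-∘ f (iter f c) xs))

head-Vmap : ∀ (f : X → Y) (xs : Vec X (suc n)) → head (Vmap f xs) ≡ f (head xs)
head-Vmap f (x ∷ xs) = refl

last-Vmap : ∀ (f : X → Y) (xs : Vec X (suc n)) → last (Vmap f xs) ≡ f (last xs)
last-Vmap f (x ∷ [])     = refl
last-Vmap f (x ∷ y ∷ xs) = last-Vmap f (y ∷ xs)

length-concat : (xss : List (List X)) → length (concat xss) ≡ List.sum (map length xss)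
length-concat []         = refl
length-concat (xs ∷ xss) = trans (length-++ xs) (cong (length xs +_) (length-concat xss))

adjacency : Adj n → Matrix n
adjacency A u v = b2n (A u v)

module _ (A : Adj n) where

  numWalks-suc : ∀ ℓ → numWalks A (suc ℓ) ≋ adjacency A · numWalks A ℓ
  numWalks-suc ℓ u v =
    trans (∑≡sum λ w → if A u w then numWalks A ℓ w v else 0) (sum-cong-≗ λ w → if-then-else-0 (A u w))
    where
    if-then-else-0 : ∀ b {x} → (if b then x else 0) ≡ b2n b * x
    if-then-else-0 true  = sym (+-identityʳ _)
    if-then-else-0 false = refl

  numWalks-sucʳ : ∀ ℓ → numWalks A (suc ℓ) ≋ numWalks A ℓ · adjacency A
  numWalks-sucʳ zero u v =
    trans (numWalks-suc 0 u v) (trans (I-identityʳ (adjacency A) u v) (sym (I-identityˡ (adjacency A) u v)))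
  numWalks-sucʳ (suc ℓ) u v = begin
    numWalks A (2 + ℓ) u v         ≡⟨ numWalks-suc (suc ℓ) u v ⟩
    (B · numWalks A (suc ℓ)) u v   ≡⟨ ·-congʳ B (numWalks-sucʳ ℓ) u v ⟩
    (B · (numWalks A ℓ · B)) u v   ≡⟨ ·-assoc B (numWalks A ℓ) B u v ⟨
    (B · numWalks A ℓ · B) u v     ≡⟨ ·-congˡ B (numWalks-suc ℓ) u v ⟨
    (numWalks A (suc ℓ) · B) u v   ∎
    where
    open ≡-Reasoning
    B : Matrix n
    B = adjacency A

  adjacency-comm-numWalks : ∀ ℓ → adjacency A · numWalks A ℓ ≋ numWalks A ℓ · adjacency A
  adjacency-comm-numWalks ℓ u v = trans (sym (numWalks-suc ℓ u v)) (numWalks-sucʳ ℓ u v)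

  adjacency-comm-numWalksUpTo : ∀ k → adjacency A · numWalksUpTo A k ≋ numWalksUpTo A k · adjacency A
  adjacency-comm-numWalksUpTo zero    = adjacency-comm-numWalks 0
  adjacency-comm-numWalksUpTo (suc k) u v = begin
    (B · (N ⊕ W)) u v           ≡⟨ ·-distribˡ-⊕ B N W u v ⟩
    (B · N) u v + (B · W) u v   ≡⟨ cong₂ _+_ (adjacency-comm-numWalksUpTo k u v) (adjacency-comm-numWalks (suc k) u v) ⟩
    (N · B) u v + (W · B) u v   ≡⟨ ·-distribʳ-⊕ N W B u v ⟨
    ((N ⊕ W) · B) u v           ∎
    where
    open ≡-Reasoning
    B N W : Matrix n
    B = adjacency A
    N = numWalksUpTo A k
    W = numWalks A (suc k)

  module _ {d : ℕ} (regular : Diregular A d) where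

    adjacency-RowSums : RowSums (adjacency A) d
    adjacency-RowSums u = trans (sym (∑≡sum (adjacency A u))) (proj₁ (regular u))

    adjacency-ColSums : ColSums (adjacency A) d
    adjacency-ColSums v = trans (sym (∑≡sum (λ u → adjacency A u v))) (proj₂ (regular v))

    numWalks-RowSums : ∀ ℓ → RowSums (numWalks A ℓ) (d ^ ℓ)
    numWalks-RowSums zero    = RowSums-I
    numWalks-RowSums (suc ℓ) =
      RowSums-cong (λ u v → sym (numWalks-suc ℓ u v)) (RowSums-· adjacency-RowSums (numWalks-RowSums ℓ))

    numWalks-ColSums : ∀ ℓ → ColSums (numWalks A ℓ) (d ^ ℓ)
    numWalks-ColSums zero    = ColSums-I
    numWalks-ColSums (suc ℓ) =
      ColSums-cong (λ u v → sym (numWalks-suc ℓ u v)) (ColSums-· adjacency-ColSums (numWalks-ColSums ℓ))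

    numWalksUpTo-RowSums : ∀ k → RowSums (numWalksUpTo A k) (suc (mooreSum d k))
    numWalksUpTo-RowSums zero    = RowSums-I
    numWalksUpTo-RowSums (suc k) = RowSums-⊕ (numWalksUpTo-RowSums k) (numWalks-RowSums (suc k))

    numWalksUpTo-ColSums : ∀ k → ColSums (numWalksUpTo A k) (suc (mooreSum d k))
    numWalksUpTo-ColSums zero    = ColSums-I
    numWalksUpTo-ColSums (suc k) = ColSums-⊕ (numWalksUpTo-ColSums k) (numWalks-ColSums (suc k))

  numWalks≤numWalksUpTo : ∀ {ℓ k} → ℓ ≤ k → ∀ u v → numWalks A ℓ u v ≤ numWalksUpTo A k u v
  numWalks≤numWalksUpTo {k = zero}  z≤n u v = ≤-refl
  numWalks≤numWalksUpTo {k = suc k} ℓ≤1+k u v with m≤n⇒m<n∨m≡n ℓ≤1+k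
  ... | inj₁ (s≤s ℓ≤k) = ≤-trans (numWalks≤numWalksUpTo ℓ≤k u v) (m≤m+n _ _)
  ... | inj₂ refl      = m≤n+m _ _

  WalkBetween : Fin n → Fin n → Vec (Fin n) (suc ℓ) → Set
  WalkBetween u v xs = IsWalk A xs × head xs ≡ u × last xs ≡ v

  walks : ∀ ℓ → Fin n → Fin n → List (Vec (Fin n) (suc ℓ))
  walks zero    u v = if does (u ≟ v) then [ u ∷ [] ] else []
  walks (suc ℓ) u v = concatMap (λ w → if A u w then map (u ∷_) (walks ℓ w v) else []) (allFin n)

  length-walks : ∀ ℓ u v → length (walks ℓ u v) ≡ numWalks A ℓ u v
  length-walks zero u v with does (u ≟ v)
  ... | true  = refl
  ... | false = refl
  length-walks (suc ℓ) u v = begin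
    length (concat (map extend (allFin n)))       ≡⟨ length-concat (map extend (allFin n)) ⟩
    List.sum (map length (map extend (allFin n))) ≡⟨ cong List.sum (map-∘ (allFin n)) ⟨
    List.sum (map (length ∘ extend) (allFin n))   ≡⟨ cong List.sum (map-cong length-extend (allFin n)) ⟩
    numWalks A (suc ℓ) u v                        ∎
    where
    open ≡-Reasoning
    extend : Fin n → List (Vec (Fin n) (2 + ℓ))
    extend w = if A u w then map (u ∷_) (walks ℓ w v) else []
    length-extend : ∀ w → length (extend w) ≡ (if A u w then numWalks A ℓ w v else 0)
    length-extend w with A u w
    ... | true  = trans (length-map (u ∷_) (walks ℓ w v)) (length-walks ℓ w v)
    ... | false = refl

  walks-complete : ∀ {ℓ u v} {xs : Vec (Fin n) (suc ℓ)} → WalkBetween u v xs → xs ∈ walks ℓ u v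
  walks-complete {zero} {xs = x ∷ []} (_ , refl , refl) with x ≟ x
  ... | yes _   = here refl
  ... | no x≢x = contradiction refl x≢x
  walks-complete {suc ℓ} {xs = x ∷ y ∷ zs} (walk , refl , refl) =
    ∈-concat⁺′ xs∈extend (∈-map⁺ _ (∈-allFin y))
    where
    xs∈extend : x ∷ y ∷ zs ∈ (if A x y then map (x ∷_) (walks ℓ y (last (y ∷ zs))) else [])
    xs∈extend rewrite walk zero = ∈-map⁺ (x ∷_) (walks-complete ((walk ∘ suc) , refl , refl))

  Reach⇒numWalks>0 : ∀ {ℓ u v} → Reach A ℓ u v → 0 < numWalks A ℓ u v
  Reach⇒numWalks>0 {ℓ} {u} {v} (_ , xs-walk) =
    subst (0 <_) (length-walks ℓ u v) (∈-length (walks-complete xs-walk))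

  Vmap-WalkBetween : ∀ {f : Fin n → Fin n} → (∀ {x y} → A x y ≡ true → A (f x) (f y) ≡ true) →
                     ∀ {ℓ u v} {xs : Vec (Fin n) (suc ℓ)} →
                     WalkBetween u v xs → WalkBetween (f u) (f v) (Vmap f xs)
  Vmap-WalkBetween {f} f-hom {xs = xs} (walk , refl , refl) = walk′ , head-Vmap f xs , last-Vmap f xs
    where
    walk′ : IsWalk A (Vmap f xs)
    walk′ i = subst₂ (λ a b → A a b ≡ true) (sym (lookup-map (inject₁ i) f xs)) (sym (lookup-map (suc i) f xs))
                (f-hom (walk i))

-- Almost Moore digraphs

module _ {A : Adj n} {d k : ℕ} {r : Fin n → Fin n} (dk : IsDKDigraph A d k) (rep : IsRepeat A k r) where

  private
    regular : Diregular A d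
    regular = proj₁ (proj₂ (proj₂ dk))

    within-k : ∀ u v → Σ ℕ λ ℓ → ℓ ≤ k × Reach A ℓ u v
    within-k = proj₁ (proj₁ (proj₂ (proj₂ (proj₂ dk))))

    n≡mooreSum : n ≡ mooreSum d k
    n≡mooreSum = proj₂ (proj₂ (proj₂ (proj₂ dk)))

    N B R : Matrix n
    N = numWalksUpTo A k
    B = adjacency A
    R u v = I (r u) v

    n+1≡1+mooreSum : n + 1 ≡ suc (mooreSum d k)
    n+1≡1+mooreSum = trans (+-comm n 1) (cong suc n≡mooreSum)

  numWalksUpTo-positive : ∀ u v → 0 < N u v
  numWalksUpTo-positive u v with within-k u v
  ... | ℓ , ℓ≤k , reachable = ≤-trans (Reach⇒numWalks>0 A reachable) (numWalks≤numWalksUpTo A ℓ≤k u v)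

  -- Each entry is positive (diameter k), the entry at (u , r u) is 2, and each row sums to n + 1.
  numWalksUpTo≡J⊕R : N ≋ J ⊕ R
  numWalksUpTo≡J⊕R u v = sym (sum-mono-≤-rigid J⊕R≤N (≤-reflexive ΣN≡ΣJ⊕R) v)
    where
    J⊕R≤N : ∀ w → 1 + I (r u) w ≤ N u w
    J⊕R≤N w with r u ≟ w
    ... | yes refl = ≤-reflexive (sym (proj₁ (proj₁ (rep u))))
    ... | no  _    = numWalksUpTo-positive u w
    ΣN≡ΣJ⊕R : sum (N u) ≡ sum ((J ⊕ R) u)
    ΣN≡ΣJ⊕R = trans (numWalksUpTo-RowSums A regular k u)
                (sym (trans (RowSums-⊕ (λ _ → sum-ones) (RowSums-I ∘ r) u) n+1≡1+mooreSum))

  numWalksUpTo≤2 : ∀ u v → N u v ≤ 2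
  numWalksUpTo≤2 u v = subst (_≤ 2) (sym (numWalksUpTo≡J⊕R u v)) (s≤s (I≤1 (r u) v))

  R-ColSums : ColSums R 1
  R-ColSums v = +-cancelˡ-≡ n _ _ (begin
    n + sum (λ u → R u v)                   ≡⟨ cong (_+ sum (λ u → R u v)) (sum-ones {n}) ⟨
    sum {n} (λ _ → 1) + sum (λ u → R u v)   ≡⟨ ∑-distrib-+ (λ _ → 1) (λ u → R u v) ⟨
    sum (λ u → (J ⊕ R) u v)                 ≡⟨ sum-cong-≗ (λ u → numWalksUpTo≡J⊕R u v) ⟨
    sum (λ u → N u v)                       ≡⟨ numWalksUpTo-ColSums A regular k v ⟩
    suc (mooreSum d k)                      ≡⟨ n+1≡1+mooreSum ⟨
    n + 1                                   ∎)
    where open ≡-Reasoning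

  -- Column r u₁ of R has sum 1 and contains the entry at u₁, so it is the indicator of u₁.
  r-injective : Injective _≡_ _≡_ r
  r-injective {u₁} {u₂} ru₁≡ru₂ =
    I≡1⇒≡ (trans (column u₂) (trans (cong (λ w → I w (r u₁)) (sym ru₁≡ru₂)) (I-diag (r u₁))))
    where
    indicator≤column : ∀ u → I u₁ u ≤ R u (r u₁)
    indicator≤column u with u₁ ≟ u
    ... | yes refl = ≤-reflexive (sym (I-diag (r u₁)))
    ... | no  _    = z≤n
    column : ∀ u → I u₁ u ≡ R u (r u₁)
    column = sum-mono-≤-rigid indicator≤column (≤-reflexive (trans (R-ColSums (r u₁)) (sym (RowSums-I u₁))))

  r-preserves-adjacency : ∀ u v → B (r u) (r v) ≡ B u v
  r-preserves-adjacency u v = +-cancelˡ-≡ d _ _ (begin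
    d + B (r u) (r v)                       ≡⟨ cong₂ _+_ (adjacency-ColSums A regular (r v))
                                                         (I-select (r u) (λ w → B w (r v))) ⟨
    sum (λ w → B w (r v)) + (R · B) u (r v) ≡⟨ cong (_+ (R · B) u (r v)) (J-· B u (r v)) ⟨
    (J · B) u (r v) + (R · B) u (r v)       ≡⟨ ·-distribʳ-⊕ J R B u (r v) ⟨
    ((J ⊕ R) · B) u (r v)                   ≡⟨ ·-congˡ B numWalksUpTo≡J⊕R u (r v) ⟨
    (N · B) u (r v)                         ≡⟨ adjacency-comm-numWalksUpTo A k u (r v) ⟨
    (B · N) u (r v)                         ≡⟨ ·-congʳ B numWalksUpTo≡J⊕R u (r v) ⟩
    (B · (J ⊕ R)) u (r v)                   ≡⟨ ·-distribˡ-⊕ B J R u (r v) ⟩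
    (B · J) u (r v) + (B · R) u (r v)       ≡⟨ cong₂ _+_ (trans (·-J B u (r v)) (adjacency-RowSums A regular u))
                                                         B·R-at-r ⟩
    d + B u v                               ∎)
    where
    open ≡-Reasoning
    B·R-at-r : (B · R) u (r v) ≡ B u v
    B·R-at-r = trans (sum-cong-≗ λ w → cong (B u w *_) (I-injective r-injective w v)) (I-identityʳ B u v)

  r-preserves-arcs : ∀ {u v} → A u v ≡ true → A (r u) (r v) ≡ true
  r-preserves-arcs {u} {v} uv with A (r u) (r v) | r-preserves-adjacency u v
  ... | true  | _    = refl
  ... | false | 0≡Buv = contradiction (trans 0≡Buv (cong b2n uv)) λ ()

  walk-fixed : ∀ {M ℓ u v} {xs : Vec (Fin n) (suc ℓ)} → iter r M u ≡ u → iter r M v ≡ v → ℓ ≤ k →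
               WalkBetween A u v xs → ∀ i → iter r (2 * M) (lookup xs i) ≡ lookup xs i
  walk-fixed {M} {ℓ} {u} {v} {xs} fixᵤ fixᵥ ℓ≤k xs-walk i = begin
    iter r (2 * M) (lookup xs i)    ≡⟨ iter-* r 2 M _ ⟨
    iter h 2 (lookup xs i)          ≡⟨ lookup-map i (iter h 2) xs ⟨
    lookup (Vmap (iter h 2) xs) i   ≡⟨ cong (λ ys → lookup ys i) (iter-Vmap h 2 xs) ⟨
    lookup (iter g 2 xs) i          ≡⟨ cong (λ ys → lookup ys i) g²xs≡xs ⟩
    lookup xs i                     ∎
    where
    open ≡-Reasoning
    h : Fin n → Fin n
    h = iter r M
    g : Vec (Fin n) (suc ℓ) → Vec (Fin n) (suc ℓ)
    g = Vmap h
    g-walk : ∀ {ys} → WalkBetween A u v ys → WalkBetween A u v (g ys)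
    g-walk ys-walk = subst₂ (λ a b → WalkBetween A a b _) fixᵤ fixᵥ
      (Vmap-WalkBetween A (iter-homomorphic r {R = λ x y → A x y ≡ true} r-preserves-arcs M) ys-walk)
    few-walks : length (walks A ℓ u v) ≤ 2
    few-walks = subst (_≤ 2) (sym (length-walks A ℓ u v))
                  (≤-trans (numWalks≤numWalksUpTo A ℓ≤k u v) (numWalksUpTo≤2 u v))
    c∣2 : ∀ {c} → 1 ≤ c → c ≤ 2 → c ∣ 2
    c∣2 {1} _ _ = 1∣ 2
    c∣2 {2} _ _ = ∣-refl
    c∣2 {suc (suc (suc _))} _ (s≤s (s≤s ()))
    g²xs≡xs : iter g 2 xs ≡ xs
    g²xs≡xs with orbit-returns (Vmap-injective (iter-injective r r-injective M)) (walks A ℓ u v)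
                   (λ t → walks-complete A (iter-preserves g {P = WalkBetween A u v} g-walk t xs-walk))
    ... | c , 1≤c , c≤length , gᶜxs≡xs = iter-periodic g gᶜxs≡xs (c∣2 1≤c (≤-trans c≤length few-walks))

  walk-vertices-InH : ∀ {α ℓ u v} {xs : Vec (Fin n) (suc ℓ)} → 1 ≤ α → InH r α u → InH r α v → ℓ ≤ k →
                      WalkBetween A u v xs → ∀ i → InH r α (lookup xs i)
  walk-vertices-InH {α} {xs = xs} 1≤α u∈H v∈H ℓ≤k xs-walk i with InH⇒fixed u∈H | InH⇒fixed v∈H
  ... | s , fixᵤ | t , fixᵥ = fixed⇒InH (suc (s ⊔ t)) 1≤α
    (subst (λ P → iter r P (lookup xs i) ≡ lookup xs i) (sym (*-assoc 2 (2 ^ (s ⊔ t)) α))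
      (walk-fixed {M = 2 ^ (s ⊔ t) * α} (fixed-mono (m≤m⊔n s t) fixᵤ) (fixed-mono (m≤n⊔m s t) fixᵥ)
                  ℓ≤k xs-walk i))

proposition1 : ∀ {n} (A : Adj n) (d k : ℕ) (r : Fin n → Fin n) →
    IsDKDigraph A d k → IsRepeat A k r →
    ∀ (α : ℕ) → 2 ≤ α → RKClosed A k r (InH r α)
proposition1 A d k r dk rep α 2≤α =
    (λ u v _ u∈H v∈H ℓ ℓ≤k xs walk head≡u last≡v _ →
       walk-vertices-InH dk rep 1≤α u∈H v∈H ℓ≤k (walk , head≡u , last≡v))
  , λ v → InH-closed-under-r 1≤α
  where
  1≤α : 1 ≤ α
  1≤α = <⇒≤ 2≤α
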